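{- Let $G$ be a connected graph and $U\subseteq V(G)$, and suppose every $U$-rooted minor of $G$ with countable branch sets has countable colouring number. Then every branch of a slim $U$-rooted normal semi-partition tree $(T,\mathcal V)$ of $G$ is at most countable; in particular, all bags $V_t$ are countable.
   Context: A minor of $G$ is given by pairwise disjoint non-empty branch sets $X_v\subseteq V(G)$ each inducing a connected subgraph, with an edge of $G$ between $X_v,X_w$ for every edge $vw$ of the minor; it is $U$-rooted if each branch set meets $U$. Countable colouring number: a well-order of the vertices with each vertex preceded by only finitely many of its neighbours. An order tree is a poset $(T,\le)$ with unique minimal element in which every $\lceil t\rceil=\{t'\le t\}$ is well-ordered; a branch is a maximal chain; $\mathring{\lceil t\rceil}=\lceil t\rceil\setminus\{t\}$, height of $t$ = order type of $\mathring{\lceil t\rceil}$. A graph on $T$ is a $T$-graph if endvertices of edges are comparable and each $t$'s lower neighbours are cofinal in $\mathring{\lceil t\rceil}$. $(T,\mathcal V)$, $\mathcal V=(V_t:t\in T)$, non-empty $V_t\subseteq V(G)$, is a normal semi-partition tree of $G$ if (a) the $V_t$ are pairwise disjoint; (b) each $G[V_t]$ is connected; (c) contracting each $V_t$ in $G[\bigcup_tV_t]$ to a vertex $t$ gives a $T$-graph; (d) every path in $G$ with both endvertices in $\bigcup_tV_t$ and no inner vertices or edges in $G[\bigcup_tV_t]$ has its endvertices in bags $V_t,V_{t'}$ with $t,t'$ comparable. It is slim if $|V_t|\le|\mathrm{height}(t)|+\aleph_0$ for all $t$, and $U$-rooted if each $V_t$ meets $U$. -}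

module Defs where

open import Level using (0ℓ)
open import Data.Nat using (ℕ)
open import Data.Product using (Σ; Σ-syntax; _×_; _,_; proj₁)
open import Data.Sum using (_⊎_; inj₁; inj₂)
open import Data.Unit using (⊤)
open import Data.List using (List)
open import Data.List.Membership.Propositional using (_∈_)
open import Relation.Nullary using (¬_)
open import Relation.Binary.PropositionalEquality using (_≡_; _≢_)
open import Relation.Binary.Structures using (IsStrictTotalOrder; IsPartialOrder)
open import Induction.WellFounded using (WellFounded)

record Graph : Set₁ where
  field
    V     : Set
    E     : V → V → Set
    sym   : ∀ {x y} → E x y → E y x
    irrefl : ∀ {x} → ¬ E x x
open Graph public

Subset : Set → Set₁
Subset A = A → Set

module _ (G : Graph) where

  data WalkIn (X : Subset (V G)) : V G → V G → Set where
    here : ∀ {x} → X x → WalkIn X x x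
    step : ∀ {x y z} → X x → E G x y → WalkIn X y z → WalkIn X x z

  ConnectedIn : Subset (V G) → Set
  ConnectedIn X = ∀ x y → X x → X y → WalkIn X x y

  Connected : Set
  Connected = V G × ConnectedIn (λ _ → ⊤)

-- Cardinality notions.  Injectivity is measured on the underlying
-- element (first component), so that proof-relevance of membership
-- does not matter.

CountableSubset : {A : Set} → Subset A → Set
CountableSubset {A} X =
  Σ[ f ∈ (Σ A X → ℕ) ] (∀ a b → f a ≡ f b → proj₁ a ≡ proj₁ b)

FiniteSubset : {A : Set} → Subset A → Set
FiniteSubset {A} X = Σ[ xs ∈ List A ] (∀ a → X a → a ∈ xs)

-- |X| ≤ |Y| + ℵ₀  for X ⊆ A, Y ⊆ B : an injection X → Y ⊎ ℕ
LeqPlusAleph0 : {A B : Set} → Subset A → Subset B → Set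
LeqPlusAleph0 {A} {B} X Y =
  Σ[ f ∈ (Σ A X → B ⊎ ℕ) ]
    ((∀ a b → f a ≡ inj₁ b → Y b) ×
     (∀ a b → f a ≡ f b → proj₁ a ≡ proj₁ b))

IsWellOrder : {A : Set} → (A → A → Set) → Set
IsWellOrder _<_ = IsStrictTotalOrder _≡_ _<_ × WellFounded _<_

HasCountableColouringNumber : Graph → Set₁
HasCountableColouringNumber G =
  Σ[ _≺_ ∈ (V G → V G → Set) ]
    (IsWellOrder _≺_ ×
     (∀ v → FiniteSubset (λ u → E G v u × u ≺ v)))

record MinorModel (G H : Graph) : Set₁ where
  field
    X         : V H → Subset (V G)
    disjoint  : ∀ {v w x} → X v x → X w x → v ≡ w
    nonempty  : ∀ v → Σ[ x ∈ V G ] X v x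
    connected : ∀ v → ConnectedIn G (X v)
    edges     : ∀ {v w} → E H v w →
                Σ[ x ∈ V G ] Σ[ y ∈ V G ] (X v x × X w y × E G x y)
open MinorModel public

Rooted : {G H : Graph} → Subset (V G) → MinorModel G H → Set
Rooted {G} {H} U M = ∀ v → Σ[ x ∈ V G ] (X M v x × U x)

CountableBranchSets : {G H : Graph} → MinorModel G H → Set
CountableBranchSets {H = H} M = ∀ v → CountableSubset (X M v)

record OrderTree : Set₁ where
  field
    T       : Set
    _≤_     : T → T → Set
    isPO    : IsPartialOrder _≡_ _≤_
    root    : T
    rootMin : ∀ t → t ≤ root → t ≡ root
    rootUnique : ∀ r → (∀ t → t ≤ r → t ≡ r) → r ≡ root
    -- ⌈t⌉ = {t' ≤ t} is well-ordered by the (strict) tree order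
    downTotal : ∀ t a b → a ≤ t → b ≤ t → (a ≤ b) ⊎ (b ≤ a)
    downWF    : ∀ t → WellFounded {A = Σ[ s ∈ T ] (s ≤ t)}
                  (λ a b → (proj₁ a ≤ proj₁ b) × (proj₁ a ≢ proj₁ b))

  _<_ : T → T → Set
  s < t = (s ≤ t) × (s ≢ t)

  Comparable : T → T → Set
  Comparable s t = (s ≤ t) ⊎ (t ≤ s)

  StrictDown : T → Subset T
  StrictDown t s = s < t

  IsChain : Subset T → Set
  IsChain C = ∀ a b → C a → C b → Comparable a b

  IsBranch : Subset T → Set₁
  IsBranch C = IsChain C ×
    (∀ (D : Subset T) → IsChain D → (∀ t → C t → D t) → ∀ t → D t → C t)

  IsTGraph : (T → T → Set) → Set
  IsTGraph F =
    (∀ s t → F s t → Comparable s t) ×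
    (∀ t s → s < t → Σ[ u ∈ T ] (s ≤ u × u < t × F u t))
open OrderTree public

module _ (G : Graph) (𝒯 : OrderTree) where

  record NormalSemiPartitionTree : Set₁ where
    field
      bag : T 𝒯 → Subset (V G)
      bagNonempty : ∀ t → Σ[ x ∈ V G ] bag t x
      bagsDisjoint : ∀ {s t x} → bag s x → bag t x → s ≡ t
      bagsConnected : ∀ t → ConnectedIn G (bag t)

    InUnion : Subset (V G)
    InUnion x = Σ[ t ∈ T 𝒯 ] bag t x

    -- edges of the graph obtained from G[⋃ V_t] by contracting each V_t
    ContractedEdge : T 𝒯 → T 𝒯 → Set
    ContractedEdge s t = (s ≢ t) ×
      Σ[ x ∈ V G ] Σ[ y ∈ V G ] (bag s x × bag t y × E G x y)

    field
      contractionIsTGraph : IsTGraph 𝒯 ContractedEdge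
      -- (d): any x–y path (x,y ∈ ⋃V_t) of length ≥ 2 whose inner vertices
      -- all lie outside ⋃V_t (hence none of its inner vertices or edges
      -- lie in G[⋃V_t]) has comparable end-bags.
      pathsComparable : ∀ {s t x y v w} → bag s x → bag t y →
        E G x v → WalkIn G (λ z → ¬ InUnion z) v w → E G w y →
        Comparable 𝒯 s t

  open NormalSemiPartitionTree public

  Slim : NormalSemiPartitionTree → Set
  Slim P = ∀ t → LeqPlusAleph0 (bag P t) (StrictDown 𝒯 t)

  RootedTree : Subset (V G) → NormalSemiPartitionTree → Set
  RootedTree U P = ∀ t → Σ[ x ∈ V G ] (bag P t x × U x)

-- Let C be a down-closed chain of T (a branch, or some ⌈t⌉°) and suppose C
-- is uncountable. The small nodes of C, those with countably many
-- predecessors, form an uncountable initial segment of C, in which every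
-- countable set has a strict upper bound. Contracting their bags gives a
-- U-rooted minor H with countable branch sets (by slimness), so H has a
-- well-order ≺ in which every vertex has finitely many earlier neighbours.
-- Choose small b₀ < b₁ < … such that b_{n+1} lies above ⌈b_n⌉ and above all
-- ≺-earlier neighbours of nodes below b_n, and let α be the least small node
-- above all b_n. By (c) every b_n lies below some lower neighbour u of α. If
-- α ≺ u, then α is an earlier neighbour of a node below some b_m, so
-- α < b_{m+1}; hence u ≺ α. But α has only finitely many ≺-earlier
-- neighbours, all below some b_M, and the lower neighbour above b_M is one of
-- them: a contradiction.
module Submission where

open import Defs
open import Data.Product using (_×_)
open import Axiom.ExcludedMiddle using (ExcludedMiddle)
open import Level using (0ℓ; suc; lift; lower)

import Data.Nat as ℕ
open import Data.Nat using (ℕ; zero; _+_; _⊔_)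
open import Data.Nat.Properties using (+-suc; +-identityʳ; m≤m⊔n; m≤n⊔m; ≤⇒≤′)
open import Data.Product using (Σ; Σ-syntax; ∃; _,_; proj₁; proj₂; map₂)
open import Data.Sum using (_⊎_; inj₁; inj₂; swap)
open import Data.Sum.Properties using (inj₁-injective; inj₂-injective)
open import Function using (_∘_)
open import Data.Unit using (⊤; tt)
open import Data.Empty using (⊥; ⊥-elim)
open import Data.Fin using (toℕ)
open import Data.Fin.Properties using (toℕ-injective)
open import Data.List using (List; map; lookup)
open import Data.List.Membership.Propositional using (_∈_)
open import Data.List.Membership.Propositional.Properties using (∈-map⁺; ∈-map⁻)
open import Data.List.Relation.Unary.All as All using (All; []; _∷_)
open import Data.List.Relation.Unary.Any using (index)
open import Data.List.Relation.Unary.Any.Properties using (lookup-index)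
open import Data.Irrelevant using ([_])
open import Data.Refinement using (Refinement; value; proof; value-injective)
open import Relation.Nullary using (¬_; Dec; yes; no)
open import Relation.Nullary.Decidable using (map′; decidable-stable; recompute)
open import Relation.Binary.PropositionalEquality as ≡
  using (_≡_; refl; trans; cong; subst; module ≡-Reasoning)
open import Relation.Binary.Definitions using (Tri; tri<; tri≈; tri>; Trichotomous)
open import Relation.Binary.Structures using (IsPartialOrder; IsStrictTotalOrder)
open import Induction.WellFounded using (Acc; acc)
import Relation.Binary.Construct.NonStrictToStrict as NonStrictToStrict

-- Cantor pairing: unpair enumerates ℕ × ℕ along the antidiagonals, and the
-- pair (a , b) is met at position a + triangle (a + b).

triangle : ℕ → ℕ
triangle zero = zero
triangle (ℕ.suc n) = ℕ.suc (n + triangle n)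

pair : ℕ × ℕ → ℕ
pair (a , b) = a + triangle (a + b)

next : ℕ × ℕ → ℕ × ℕ
next (a , zero) = zero , ℕ.suc a
next (a , ℕ.suc b) = ℕ.suc a , b

unpair : ℕ → ℕ × ℕ
unpair zero = zero , zero
unpair (ℕ.suc n) = next (unpair n)

unpair-antidiagonal : ∀ n a b → a + b ≡ n → unpair (a + triangle n) ≡ (a , b)
unpair-antidiagonal zero zero zero refl = refl
unpair-antidiagonal (ℕ.suc n) zero b refl =
  cong next (unpair-antidiagonal n n zero (+-identityʳ n))
unpair-antidiagonal n (ℕ.suc a) b a+b≡n =
  cong next (unpair-antidiagonal n a (ℕ.suc b) (trans (+-suc a b) a+b≡n))

pair-injective : ∀ {p q} → pair p ≡ pair q → p ≡ q
pair-injective {p@(a , b)} {q@(c , d)} e = begin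
  p                ≡⟨ unpair-antidiagonal (a + b) a b refl ⟨
  unpair (pair p)  ≡⟨ cong unpair e ⟩
  unpair (pair q)  ≡⟨ unpair-antidiagonal (c + d) c d refl ⟩
  q                ∎
  where open ≡-Reasoning

tag : ℕ ⊎ ℕ → ℕ
tag (inj₁ n) = pair (0 , n)
tag (inj₂ n) = pair (1 , n)

tag-injective : ∀ {x y} → tag x ≡ tag y → x ≡ y
tag-injective {inj₁ m} {inj₁ n} e with pair-injective {0 , m} {0 , n} e
... | refl = refl
tag-injective {inj₁ m} {inj₂ n} e with pair-injective {0 , m} {1 , n} e
... | ()
tag-injective {inj₂ m} {inj₁ n} e with pair-injective {1 , m} {0 , n} e
... | ()
tag-injective {inj₂ m} {inj₂ n} e with pair-injective {1 , m} {1 , n} e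
... | refl = refl

InjectiveOn : {A B : Set} (X : Subset A) → (Σ A X → B) → Set
InjectiveOn X f = ∀ u v → f u ≡ f v → proj₁ u ≡ proj₁ v

Union : {I B : Set} → Subset I → (I → Subset B) → Subset B
Union {I} S F b = Σ[ i ∈ I ] (S i × F i b)

module _ {A : Set} where

  countable-⊆ : {X Y : Subset A} → (∀ a → X a → Y a) →
    CountableSubset Y → CountableSubset X
  countable-⊆ X⊆Y (f , f-inj) = (λ (a , x) → f (a , X⊆Y a x)) , λ _ _ → f-inj _ _

  countable-singleton : (a : A) → CountableSubset (_≡ a)
  countable-singleton a = (λ _ → 0) , λ { (_ , refl) (_ , refl) _ → refl }

  countable-via-⊎ : {X : Subset A} (f : Σ A X → ℕ ⊎ ℕ) → InjectiveOn X f →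
    CountableSubset X
  countable-via-⊎ f f-inj = tag ∘ f , λ u v e → f-inj u v (tag-injective e)

  countable-⊎ : {X Y : Subset A} → CountableSubset X → CountableSubset Y →
    CountableSubset (λ a → X a ⊎ Y a)
  countable-⊎ {X} {Y} (f , f-inj) (g , g-inj) = countable-via-⊎ code code-inj
    where
    code : Σ A (λ a → X a ⊎ Y a) → ℕ ⊎ ℕ
    code (a , inj₁ x) = inj₁ (f (a , x))
    code (a , inj₂ y) = inj₂ (g (a , y))
    code-inj : InjectiveOn _ code
    code-inj (a , inj₁ x) (b , inj₁ y) e = f-inj _ _ (inj₁-injective e)
    code-inj (a , inj₂ x) (b , inj₂ y) e = g-inj _ _ (inj₂-injective e)

  countable-≤+ℵ₀ : {B : Set} {X : Subset A} {Y : Subset B} →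
    LeqPlusAleph0 X Y → CountableSubset Y → CountableSubset X
  countable-≤+ℵ₀ {B} {Y = Y} (φ , φ-in-Y , φ-inj) (g , g-inj) =
    countable-via-⊎ (λ u → recode (φ u) (φ-in-Y u)) (λ u v e → φ-inj u v (recode-inj e))
    where
    recode : (s : B ⊎ ℕ) → (∀ b → s ≡ inj₁ b → Y b) → ℕ ⊎ ℕ
    recode (inj₁ b) in-Y = inj₁ (g (b , in-Y b refl))
    recode (inj₂ n) _ = inj₂ n
    recode-inj : ∀ {s t p q} → recode s p ≡ recode t q → s ≡ t
    recode-inj {inj₁ _} {inj₁ _} e = cong inj₁ (g-inj _ _ (inj₁-injective e))
    recode-inj {inj₂ _} {inj₂ _} e = cong inj₂ (inj₂-injective e)

  finite⇒countable : {X : Subset A} → FiniteSubset X → CountableSubset X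
  finite⇒countable (xs , ∈xs) = (λ (a , x) → toℕ (index (∈xs a x))) , code-inj
    where
    code-inj : InjectiveOn _ _
    code-inj (a , x) (b , y) e = begin
      a                            ≡⟨ lookup-index (∈xs a x) ⟩
      lookup xs (index (∈xs a x))  ≡⟨ cong (lookup xs) (toℕ-injective e) ⟩
      lookup xs (index (∈xs b y))  ≡⟨ lookup-index (∈xs b y) ⟨
      b                            ∎
      where open ≡-Reasoning

countable-preimage : {A B : Set} {Y : Subset B} (f : A → B) →
  (∀ {a a′} → f a ≡ f a′ → a ≡ a′) →
  CountableSubset Y → CountableSubset (λ a → Y (f a))
countable-preimage f f-inj (g , g-inj) =
  (λ (a , y) → g (f a , y)) , λ _ _ e → f-inj (g-inj _ _ e)

countable-⋃-uniform : {I B : Set} {S : Subset I} {F : I → Subset B} →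
  CountableSubset S → (h : ∀ i → Σ B (F i) → ℕ) → (∀ i → S i → InjectiveOn (F i) (h i)) →
  CountableSubset (Union S F)
countable-⋃-uniform {S = S} {F} (g , g-inj) h h-inj = code , code-inj
  where
  code : Σ _ (Union S F) → ℕ
  code (b , i , s , x) = pair (g (i , s) , h i (b , x))
  code-inj : InjectiveOn _ code
  code-inj (b , i , s , x) (c , j , t , y) e =
    same-component (pair-injective {g (i , s) , h i (b , x)} {g (j , t) , h j (c , y)} e)
    where
    same-component : (g (i , s) , h i (b , x)) ≡ (g (j , t) , h j (c , y)) → b ≡ c
    same-component e′ with g-inj (i , s) (j , t) (cong proj₁ e′)
    ... | refl = h-inj i s (b , x) (c , y) (cong proj₂ e′)

eventually-all : {A : Set} (Q : A → ℕ → Set) → (∀ {x m n} → m ℕ.≤ n → Q x m → Q x n) →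
  {xs : List A} → All (λ x → ∃ (Q x)) xs → ∃ λ M → All (λ x → Q x M) xs
eventually-all Q mono [] = 0 , []
eventually-all Q mono ((m , q) ∷ qs) with eventually-all Q mono qs
... | M , qs-M = m ⊔ M , mono (m≤m⊔n m M) q ∷ All.map (mono (m≤n⊔m m M)) qs-M

module TreeOrder (𝒯 : OrderTree) where
  open OrderTree 𝒯 public using ()
    renaming (T to Node; _≤_ to _⊑_; _<_ to _⊏_; isPO to ⊑-isPartialOrder)
  open IsPartialOrder ⊑-isPartialOrder public using ()
    renaming (refl to ⊑-refl; trans to ⊑-trans; antisym to ⊑-antisym)

  ⊏-⊑-trans : ∀ {s t u} → s ⊏ t → t ⊑ u → s ⊏ u
  ⊏-⊑-trans = NonStrictToStrict.<-≤-trans _≡_ _⊑_ ≡.sym ⊑-trans ⊑-antisym λ { refl p → p }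

  ⊑-⊏-trans : ∀ {s t u} → s ⊑ t → t ⊏ u → s ⊏ u
  ⊑-⊏-trans = NonStrictToStrict.≤-<-trans _≡_ _⊑_ ⊑-trans ⊑-antisym λ { refl p → p }

  ⊏-irrefl : ∀ {s} → ¬ s ⊏ s
  ⊏-irrefl (_ , s≢s) = s≢s refl

  comparable∧⋢⇒⊏ : ∀ {s t} → Comparable 𝒯 s t → ¬ t ⊑ s → s ⊏ t
  comparable∧⋢⇒⊏ (inj₁ s⊑t) t⋢s = s⊑t , λ { refl → t⋢s ⊑-refl }
  comparable∧⋢⇒⊏ (inj₂ t⊑s) t⋢s = ⊥-elim (t⋢s t⊑s)

  DownClosed : Subset Node → Set
  DownClosed C = ∀ {s t} → s ⊑ t → C t → C s

  branch-downClosed : ∀ {C} → IsBranch 𝒯 C → DownClosed C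
  branch-downClosed {C} (C-chain , C-maximal) {s} {t} s⊑t Ct =
    C-maximal (λ x → C x ⊎ x ≡ s) extended-chain (λ _ → inj₁) s (inj₂ refl)
    where
    comparable-s : ∀ a → C a → Comparable 𝒯 a s
    comparable-s a Ca with C-chain a t Ca Ct
    ... | inj₁ a⊑t = downTotal 𝒯 t a s a⊑t s⊑t
    ... | inj₂ t⊑a = inj₂ (⊑-trans s⊑t t⊑a)
    extended-chain : IsChain 𝒯 (λ x → C x ⊎ x ≡ s)
    extended-chain a c (inj₁ Ca) (inj₁ Cc) = C-chain a c Ca Cc
    extended-chain a _ (inj₁ Ca) (inj₂ refl) = comparable-s a Ca
    extended-chain _ c (inj₂ refl) (inj₁ Cc) = swap (comparable-s c Cc)
    extended-chain _ _ (inj₂ refl) (inj₂ refl) = inj₁ ⊑-refl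

  strictDown-downClosed : ∀ t → DownClosed (StrictDown 𝒯 t)
  strictDown-downClosed t = ⊑-⊏-trans

  strictDown-chain : ∀ t → IsChain 𝒯 (StrictDown 𝒯 t)
  strictDown-chain t a c (a⊑t , _) (c⊑t , _) = downTotal 𝒯 t a c a⊑t c⊑t

module _ {G : Graph} {𝒯 : OrderTree} (P : NormalSemiPartitionTree G 𝒯) where

  contractedEdge-sym : ∀ {s t} → ContractedEdge P s t → ContractedEdge P t s
  contractedEdge-sym (s≢t , x , y , x∈s , y∈t , xy) =
    (λ t≡s → s≢t (≡.sym t≡s)) , y , x , y∈t , x∈s , Graph.sym G xy

  -- The membership proof in a vertex is irrelevant, so that vertices with the
  -- same node are equal; this makes the bags disjoint branch sets.
  Contraction : Subset (T 𝒯) → Graph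
  Contraction S = record
    { V = Refinement (T 𝒯) S
    ; E = λ v w → ContractedEdge P (value v) (value w)
    ; sym = contractedEdge-sym
    ; irrefl = λ e → proj₁ e refl
    }

  contractionModel : (S : Subset (T 𝒯)) → MinorModel G (Contraction S)
  contractionModel S = record
    { X = λ v → bag P (value v)
    ; disjoint = λ x∈v x∈w → value-injective (bagsDisjoint P x∈v x∈w)
    ; nonempty = λ v → bagNonempty P (value v)
    ; connected = λ v → bagsConnected P (value v)
    ; edges = λ (_ , x , y , x∈v , y∈w , xy) → x , y , x∈v , y∈w , xy
    }

module Classical (em : ExcludedMiddle (suc 0ℓ)) where

  dec : (P : Set) → Dec P
  dec P = map′ lower lift em

  dne : {P : Set} → ¬ ¬ P → P
  dne {P} = decidable-stable (dec P)

  -- Chosen from X alone, not from a proof that X is countable, so that a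
  -- union indexed by proof-relevant memberships can use it uniformly.
  counting : {A : Set} (X : Subset A) → Σ A X → ℕ
  counting X with dec (CountableSubset X)
  ... | yes (f , _) = f
  ... | no _ = λ _ → 0

  counting-injective : {A : Set} {X : Subset A} → CountableSubset X →
    InjectiveOn X (counting X)
  counting-injective {X = X} X-countable with dec (CountableSubset X)
  ... | yes (_ , f-inj) = f-inj
  ... | no X-uncountable = ⊥-elim (X-uncountable X-countable)

  countable-⋃ : {I B : Set} {S : Subset I} {F : I → Subset B} →
    CountableSubset S → (∀ i → S i → CountableSubset (F i)) →
    CountableSubset (Union S F)
  countable-⋃ {F = F} S-countable F-countable = countable-⋃-uniform S-countable
    (λ i → counting (F i)) (λ i i∈S → counting-injective (F-countable i i∈S))

  module _ (𝒯 : OrderTree) where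
    open TreeOrder 𝒯

    MinimalIn : Subset Node → Subset Node
    MinimalIn P a = P a × (∀ s → s ⊏ a → ¬ P s)

    minimal : ∀ {P d} → P d → ∃ (MinimalIn P)
    minimal {P} {d} Pd = descend (d , ⊑-refl) (downWF 𝒯 d _) Pd
      where
      descend : (x : Σ Node (_⊑ d)) → Acc _ x → P (proj₁ x) → ∃ (MinimalIn P)
      descend (a , a⊑d) (acc below) Pa with dec (Σ[ s ∈ Node ] (s ⊏ a × P s))
      ... | yes (s , s⊏a , Ps) = descend (s , ⊑-trans (proj₁ s⊏a) a⊑d) (below {s , _} s⊏a) Ps
      ... | no nothing-below = a , Pa , λ s s⊏a Ps → nothing-below (s , s⊏a , Ps)

    down-countable : ∀ t → CountableSubset (StrictDown 𝒯 t) → CountableSubset (_⊑ t)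
    down-countable t strictDown-countable =
      countable-⊆ strict-or-equal (countable-⊎ strictDown-countable (countable-singleton t))
      where
      strict-or-equal : ∀ s → s ⊑ t → s ⊏ t ⊎ s ≡ t
      strict-or-equal s s⊑t with dec (s ≡ t)
      ... | yes s≡t = inj₂ s≡t
      ... | no s≢t = inj₁ (s⊑t , s≢t)

  module _ {G : Graph} {U : Subset (V G)}
    (minors-colourable : ∀ (H : Graph) (M : MinorModel G H) →
       Rooted U M → CountableBranchSets M → HasCountableColouringNumber H)
    {𝒯 : OrderTree} (P : NormalSemiPartitionTree G 𝒯)
    (slim : Slim G 𝒯 P) (rooted : RootedTree G 𝒯 U P) where
    open TreeOrder 𝒯

    module UncountableChain {C : Subset Node} (C-down : DownClosed C)
      (C-chain : IsChain 𝒯 C) (C-uncountable : ¬ CountableSubset C) where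

      Small : Subset Node
      Small t = C t × CountableSubset (StrictDown 𝒯 t)

      small-downClosed : DownClosed Small
      small-downClosed s⊑t (Ct , t-small) =
        C-down s⊑t Ct , countable-⊆ (λ _ r⊏s → ⊏-⊑-trans r⊏s s⊑t) t-small

      small-uncountable : ¬ CountableSubset Small
      small-uncountable Small-countable = C-uncountable (countable-⊆ C⊆Small Small-countable)
        where
        C⊆Small : ∀ c → C c → Small c
        C⊆Small c Cc = dne λ c-large → large-minimal (minimal 𝒯 (Cc , c-large))
          where
          large-minimal : ¬ ∃ (MinimalIn 𝒯 (λ x → C x × ¬ Small x))
          large-minimal (a , (Ca , a-large) , a-min) = a-large (Ca ,
            countable-⊆ (λ s s⊏a → dne λ s-large → a-min s s⊏a (C-down (proj₁ s⊏a) Ca , s-large))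
              Small-countable)

      small-bounded : ∀ {Q} → (∀ s → Q s → Small s) → CountableSubset Q →
        Σ[ β ∈ Node ] (Small β × ∀ s → Q s → s ⊏ β)
      small-bounded {Q} Q⊆Small Q-countable = dne λ unbounded →
        small-uncountable (countable-⊆ (covered unbounded)
          (countable-⋃ Q-countable λ s Qs → down-countable 𝒯 s (proj₂ (Q⊆Small s Qs))))
        where
        covered : ¬ (Σ[ β ∈ Node ] (Small β × ∀ s → Q s → s ⊏ β)) →
          ∀ d → Small d → Union Q (λ s d → d ⊑ s) d
        covered unbounded d d-small = dne λ uncovered → unbounded (d , d-small , λ s Qs →
          comparable∧⋢⇒⊏ (C-chain s d (proj₁ (Q⊆Small s Qs)) (proj₁ d-small))
            λ d⊑s → uncovered (s , Qs , d⊑s))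

      H : Graph
      H = Contraction P Small

      vertex : ∀ {t} → Small t → V H
      vertex {t} t-small = record { value = t ; proof = [ t-small ] }

      small : (v : V H) → Small (value v)
      small record { value = t ; proof = [ t-small ] } = recompute (dec (Small t)) t-small

      H-colouring : HasCountableColouringNumber H
      H-colouring = minors-colourable H (contractionModel P Small)
        (λ v → rooted (value v))
        (λ v → countable-≤+ℵ₀ (slim (value v)) (proj₂ (small v)))

      _≺_ : V H → V H → Set
      _≺_ = proj₁ H-colouring

      ≺-compare : Trichotomous _≡_ _≺_
      ≺-compare = IsStrictTotalOrder.compare (proj₁ (proj₁ (proj₂ H-colouring)))

      earlierNeighbours : V H → List (V H)
      earlierNeighbours v = proj₁ (proj₂ (proj₂ H-colouring) v)

      earlierNeighbours-complete : ∀ {v w} → E H v w → w ≺ v → w ∈ earlierNeighbours v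
      earlierNeighbours-complete {v} {w} vw w≺v = proj₂ (proj₂ (proj₂ H-colouring) v) w (vw , w≺v)

      EarlierNeighbour : V H → Subset Node
      EarlierNeighbour u x = x ∈ map value (earlierNeighbours u)

      BelowOrEarlier : Node → Subset Node
      BelowOrEarlier b x = x ⊑ b ⊎ Union (λ u → value u ⊑ b) EarlierNeighbour x

      belowOrEarlier-small : ∀ {b} → Small b → ∀ x → BelowOrEarlier b x → Small x
      belowOrEarlier-small b-small x (inj₁ x⊑b) = small-downClosed x⊑b b-small
      belowOrEarlier-small b-small x (inj₂ (u , _ , x∈)) with ∈-map⁻ value x∈
      ... | w , _ , refl = small w

      belowOrEarlier-countable : ∀ {b} → Small b → CountableSubset (BelowOrEarlier b)
      belowOrEarlier-countable {b} b-small = countable-⊎ down-b-countable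
        (countable-⋃ (countable-preimage value value-injective down-b-countable)
          λ u _ → finite⇒countable (map value (earlierNeighbours u) , λ _ x∈ → x∈))
        where
        down-b-countable : CountableSubset (_⊑ b)
        down-b-countable = down-countable 𝒯 b (proj₂ b-small)

      absorb : (b : ∃ Small) → Σ[ β ∈ Node ] (Small β × ∀ x → BelowOrEarlier (proj₁ b) x → x ⊏ β)
      absorb (b , b-small) =
        small-bounded (belowOrEarlier-small b-small) (belowOrEarlier-countable b-small)

      sequence : ℕ → ∃ Small
      -- a strict upper bound of the empty set is just some small node
      sequence zero = map₂ proj₁ (small-bounded {Q = λ _ → ⊥} (λ _ ()) ((λ ()) , λ ()))
      sequence (ℕ.suc n) = map₂ proj₁ (absorb (sequence n))

      b : ℕ → Node
      b n = proj₁ (sequence n)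

      b-small : ∀ n → Small (b n)
      b-small n = proj₂ (sequence n)

      b-absorbs : ∀ n {x} → BelowOrEarlier (b n) x → x ⊏ b (ℕ.suc n)
      b-absorbs n = proj₂ (proj₂ (absorb (sequence n))) _

      b-step : ∀ n → b n ⊏ b (ℕ.suc n)
      b-step n = b-absorbs n (inj₁ ⊑-refl)

      b-mono : ∀ {m n} → m ℕ.≤′ n → b m ⊑ b n
      b-mono ℕ.≤′-refl = ⊑-refl
      b-mono (ℕ.≤′-step {n} m≤′n) = ⊑-trans (b-mono m≤′n) (proj₁ (b-step n))

      BelowSome : Subset Node
      BelowSome x = ∃ λ n → x ⊏ b n

      belowSome-countable : CountableSubset BelowSome
      belowSome-countable = countable-⊆ (λ _ (n , x⊏bn) → n , tt , x⊏bn)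
        (countable-⋃ {S = λ _ → ⊤} (proj₁ , λ _ _ e → e) λ n _ → proj₂ (b-small n))

      module Escape {α : Node} (α-small : Small α) (α-escapes : ¬ BelowSome α)
        (α-min : ∀ s → s ⊏ α → ¬ (Small s × ¬ BelowSome s)) where

        below-α-belowSome : ∀ {s} → s ⊏ α → BelowSome s
        below-α-belowSome s⊏α =
          dne λ s-escapes → α-min _ s⊏α (small-downClosed (proj₁ s⊏α) α-small , s-escapes)

        b⊏α : ∀ n → b n ⊏ α
        b⊏α n = comparable∧⋢⇒⊏ (C-chain _ _ (proj₁ (b-small n)) (proj₁ α-small))
          λ α⊑bn → α-escapes (ℕ.suc n , ⊑-⊏-trans α⊑bn (b-step n))

        αᴴ : V H
        αᴴ = vertex α-small

        lowerVertex : ∀ {u} → u ⊏ α → V H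
        lowerVertex u⊏α = vertex (small-downClosed (proj₁ u⊏α) α-small)

        α-not-before : ∀ {u} (u⊏α : u ⊏ α) → ContractedEdge P u α → ¬ αᴴ ≺ lowerVertex u⊏α
        α-not-before u⊏α uα α≺u with below-α-belowSome u⊏α
        ... | m , u⊏bm = α-escapes (ℕ.suc m , b-absorbs m (inj₂ (lowerVertex u⊏α , proj₁ u⊏bm ,
          ∈-map⁺ value (earlierNeighbours-complete {lowerVertex u⊏α} {αᴴ} uα α≺u))))

        lower-neighbour-earlier : ∀ {u} (u⊏α : u ⊏ α) → ContractedEdge P u α →
          lowerVertex u⊏α ∈ earlierNeighbours αᴴ
        lower-neighbour-earlier {u} u⊏α uα = by-trichotomy (≺-compare αᴴ uᴴ)
          where
          uᴴ : V H
          uᴴ = lowerVertex u⊏α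
          by-trichotomy : Tri (αᴴ ≺ uᴴ) (αᴴ ≡ uᴴ) (uᴴ ≺ αᴴ) → uᴴ ∈ earlierNeighbours αᴴ
          by-trichotomy (tri< α≺u _ _) = ⊥-elim (α-not-before u⊏α uα α≺u)
          by-trichotomy (tri≈ _ α≡u _) = ⊥-elim (⊏-irrefl (subst (_⊏ α) (≡.sym (cong value α≡u)) u⊏α))
          by-trichotomy (tri> _ _ u≺α) =
            earlierNeighbours-complete {αᴴ} {uᴴ} (contractedEdge-sym P uα) u≺α

        earlier-neighbour-above : ∀ n →
          Σ[ w ∈ V H ] (b n ⊑ value w × value w ⊏ α × w ∈ earlierNeighbours αᴴ)
        earlier-neighbour-above n =
          let u , bn⊑u , u⊏α , uα = proj₂ (contractionIsTGraph P) α (b n) (b⊏α n)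
          in lowerVertex u⊏α , bn⊑u , u⊏α , lower-neighbour-earlier u⊏α uα

        eventually-above : (w : V H) → ∃ λ n → value w ⊏ α → value w ⊏ b n
        eventually-above w with dec (value w ⊏ α)
        ... | yes w⊏α = map₂ (λ w⊏bn _ → w⊏bn) (below-α-belowSome w⊏α)
        ... | no w⋢α = 0 , λ w⊏α → ⊥-elim (w⋢α w⊏α)

        absurd : ⊥
        absurd =
          let M , below-b-M = eventually-all (λ w n → value w ⊏ α → value w ⊏ b n)
                (λ m≤n below-m w⊏α → ⊏-⊑-trans (below-m w⊏α) (b-mono (≤⇒≤′ m≤n)))
                (All.tabulate {xs = earlierNeighbours αᴴ} λ {w} _ → eventually-above w)
              w , bM⊑w , w⊏α , w∈ = earlier-neighbour-above M
          in ⊏-irrefl (⊏-⊑-trans (All.lookup below-b-M w∈ w⊏α) bM⊑w)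

      escaping-node : ∃ λ x → Small x × ¬ BelowSome x
      escaping-node = dne λ none-escapes →
        small-uncountable (countable-⊆ (λ x x-small → dne λ x-escapes →
          none-escapes (x , x-small , x-escapes)) belowSome-countable)

      absurd : ⊥
      absurd =
        let _ , (α-small , α-escapes) , α-min =
              minimal 𝒯 {λ x → Small x × ¬ BelowSome x} (proj₂ escaping-node)
        in Escape.absurd α-small α-escapes α-min

    downClosedChain-countable : ∀ {C} → DownClosed C → IsChain 𝒯 C → CountableSubset C
    downClosedChain-countable C-down C-chain =
      dne λ C-uncountable → UncountableChain.absurd C-down C-chain C-uncountable

lemma5p2 : ExcludedMiddle (suc 0ℓ) →
    (G : Graph) → Connected G → (U : Subset (V G)) →
    (∀ (H : Graph) (M : MinorModel G H) →
       Rooted U M → CountableBranchSets M → HasCountableColouringNumber H) →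
    (𝒯 : OrderTree) (P : NormalSemiPartitionTree G 𝒯) →
    Slim G 𝒯 P → RootedTree G 𝒯 U P →
    (∀ (C : Subset (T 𝒯)) → IsBranch 𝒯 C → CountableSubset C) ×
    (∀ t → CountableSubset (bag P t))
lemma5p2 em G _ U minors-colourable 𝒯 P slim rooted = branch-countable , bag-countable
  where
  open Classical em
  open TreeOrder 𝒯

  countable : ∀ {C} → DownClosed C → IsChain 𝒯 C → CountableSubset C
  countable = downClosedChain-countable minors-colourable P slim rooted

  branch-countable : ∀ C → IsBranch 𝒯 C → CountableSubset C
  branch-countable C C-branch = countable (branch-downClosed C-branch) (proj₁ C-branch)

  bag-countable : ∀ t → CountableSubset (bag P t)
  bag-countable t =
    countable-≤+ℵ₀ (slim t) (countable (strictDown-downClosed t) (strictDown-chain t))
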